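{- (Density.) Let $X,Y$ be sets. (1) If $f,g:\mathcal{S}X\to\mathcal{S}Y$ are global and $f(\lambda\_.x)=g(\lambda\_.x)$ for all $x\in X$, then $f=g$. (2) If $f:\mathcal{S}X\to\mathcal{S}Y$ is global and $f(\alpha)$ is an individual for every constant individual $\alpha$, then $f(\beta)$ is an individual for every individual $\beta$.
   Context: $\mathbb{S}$ is a set of states partially ordered by inclusion $\sqsubseteq$ (states are finite sets of triples $\langle P,\vec m,n\rangle$, $P$ a primitive recursive predicate symbol, satisfying $P(\vec m,n)$ in the standard model and at most one $n$ per $(P,\vec m)$). $\mathcal{S}X$ denotes the set of functions $\mathbb{S}\to X$; $\lambda\_.x$ denotes the constant function with value $x$, and such elements are called constant individuals. A weakly increasing sequence is $\sigma:\mathbb{N}\to\mathbb{S}$ with $\sigma(i)\sqsubseteq\sigma(j)$ for $i\le j$. An individual (strongly convergent element) is $\alpha\in\mathcal{S}X$ such that for every weakly increasing $\sigma$ the sequence $\alpha(\sigma(i))$ is eventually constant. A function $f:\mathcal{S}X\to\mathcal{S}Y$ is global (has global state) if $f(\alpha)(s)=f(\lambda\_.\alpha(s))(s)$ for all $\alpha\in\mathcal{S}X$, $s\in\mathbb{S}$. -}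

module Defs where

open import Data.Nat using (ℕ; zero; suc; _≤_)
open import Data.Fin using (Fin)
open import Data.Vec using (Vec; []; _∷_; lookup; _∷ʳ_)
open import Data.List using (List)
open import Data.List.Relation.Unary.All using (All)
open import Data.List.Membership.Propositional using (_∈_)
open import Data.Product using (Σ; _×_; _,_; ∃)
open import Relation.Binary.PropositionalEquality using (_≡_; _≢_)

data PR : ℕ → Set where
  Z    : ∀ {n} → PR n
  S    : PR 1
  proj : ∀ {n} → Fin n → PR n
  comp : ∀ {m n} → PR m → Vec (PR n) m → PR n
  rec  : ∀ {n} → PR n → PR (suc (suc n)) → PR (suc n)

mutual
  eval : ∀ {n} → PR n → Vec ℕ n → ℕ
  eval Z _ = 0
  eval S (x ∷ []) = suc x
  eval (proj i) v = lookup v i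
  eval (comp f gs) v = eval f (evalAll gs v)
  eval (rec f g) (zero ∷ v) = eval f v
  eval (rec f g) (suc x ∷ v) = eval g (x ∷ eval (rec f g) (x ∷ v) ∷ v)

  evalAll : ∀ {m n} → Vec (PR n) m → Vec ℕ n → Vec ℕ m
  evalAll [] v = []
  evalAll (g ∷ gs) v = eval g v ∷ evalAll gs v

-- A primitive recursive predicate symbol of arity k+1 is given by (a code of)
-- its characteristic function; P(m⃗ , n) holds in the standard model iff the
-- characteristic function is nonzero there.
PredSym : ℕ → Set
PredSym k = PR (suc k)

Triple : Set
Triple = Σ ℕ λ k → PredSym k × Vec ℕ k × ℕ

Holds : Triple → Set
Holds (k , P , ms , n) = eval P (ms ∷ʳ n) ≢ 0

-- States: finite sets (given by lists, read as sets via membership) of true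
-- triples with at most one n per (P , m⃗).
record State : Set where
  field
    triples    : List Triple
    sound      : All Holds triples
    functional : ∀ {k} {P : PredSym k} {ms : Vec ℕ k} {n n′ : ℕ}
               → (k , P , ms , n) ∈ triples → (k , P , ms , n′) ∈ triples → n ≡ n′
open State public

_⊑_ : State → State → Set
s ⊑ t = ∀ {x} → x ∈ triples s → x ∈ triples t

𝒮 : Set → Set
𝒮 X = State → X

const𝒮 : ∀ {X : Set} → X → 𝒮 X
const𝒮 x = λ _ → x

WeaklyIncreasing : (ℕ → State) → Set
WeaklyIncreasing σ = ∀ i j → i ≤ j → σ i ⊑ σ j

EventuallyConstant : ∀ {X : Set} → (ℕ → X) → Set
EventuallyConstant a = ∃ λ N → ∀ i → N ≤ i → a i ≡ a N

Individual : ∀ {X : Set} → 𝒮 X → Set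
Individual α = ∀ σ → WeaklyIncreasing σ → EventuallyConstant (λ i → α (σ i))

Global : ∀ {X Y : Set} → (𝒮 X → 𝒮 Y) → Set
Global f = ∀ α s → f α s ≡ f (const𝒮 (α s)) s

module Submission where

-- A global function f : 𝒮 X → 𝒮 Y only ever inspects its argument at the
-- current state: f α s = f (λ_. α s) s.  Both parts follow from this.
--
-- (1) Two global functions agreeing on constants agree everywhere, since at
--     every state each of them reduces to its value on a constant.
-- (2) Along a weakly increasing σ an individual β eventually equals some x, so
--     f β (σ i) eventually coincides with f (λ_. x) (σ i), which is eventually
--     constant because f (λ_. x) is an individual.  The remaining step is the
--     general fact that a sequence which eventually coincides with an
--     eventually constant one is itself eventually constant.

open import Defs
open import Data.Nat using (ℕ; _≤_; _⊔_)
open import Data.Nat.Properties using (m≤m⊔n; m≤n⊔m; ≤-trans; ≤-refl)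
open import Data.Product using (_×_; _,_; ∃)
open import Relation.Binary.PropositionalEquality using (_≡_; sym; cong)
open Relation.Binary.PropositionalEquality.≡-Reasoning

EventuallyEqual : ∀ {A : Set} → (ℕ → A) → (ℕ → A) → Set
EventuallyEqual a b = ∃ λ N → ∀ i → N ≤ i → a i ≡ b i

eventuallyConstant-resp : ∀ {A : Set} {a b : ℕ → A} →
  EventuallyEqual a b → EventuallyConstant b → EventuallyConstant a
eventuallyConstant-resp {a = a} {b} (N , a≡b) (K , b≡bK) = M , a≡aM
  where
  M = N ⊔ K
  a≡bK : ∀ i → M ≤ i → a i ≡ b K
  a≡bK i M≤i = begin
    a i  ≡⟨ a≡b i (≤-trans (m≤m⊔n N K) M≤i) ⟩
    b i  ≡⟨ b≡bK i (≤-trans (m≤n⊔m N K) M≤i) ⟩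
    b K  ∎
  a≡aM : ∀ i → M ≤ i → a i ≡ a M
  a≡aM i M≤i = begin
    a i  ≡⟨ a≡bK i M≤i ⟩
    b K  ≡⟨ sym (a≡bK M ≤-refl) ⟩
    a M  ∎

global-unique : ∀ {X Y : Set} (f g : 𝒮 X → 𝒮 Y) → Global f → Global g →
  (∀ x s → f (const𝒮 x) s ≡ g (const𝒮 x) s) →
  ∀ α s → f α s ≡ g α s
global-unique f g global-f global-g agree α s = begin
  f α s               ≡⟨ global-f α s ⟩
  f (const𝒮 (α s)) s  ≡⟨ agree (α s) s ⟩
  g (const𝒮 (α s)) s  ≡⟨ sym (global-g α s) ⟩
  g α s               ∎

global-eventuallyEqual : ∀ {X Y : Set} (f : 𝒮 X → 𝒮 Y) → Global f →
  ∀ (β : 𝒮 X) (σ : ℕ → State) (x : X) →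
  EventuallyEqual (λ i → β (σ i)) (λ _ → x) →
  EventuallyEqual (λ i → f β (σ i)) (λ i → f (const𝒮 x) (σ i))
global-eventuallyEqual f global-f β σ x (N , β≡x) = N , λ i N≤i → begin
  f β (σ i)                   ≡⟨ global-f β (σ i) ⟩
  f (const𝒮 (β (σ i))) (σ i)  ≡⟨ cong (λ z → f (const𝒮 z) (σ i)) (β≡x i N≤i) ⟩
  f (const𝒮 x) (σ i)          ∎

global-preserves-individuals : ∀ {X Y : Set} (f : 𝒮 X → 𝒮 Y) → Global f →
  (∀ x → Individual (f (const𝒮 x))) →
  ∀ β → Individual β → Individual (f β)
global-preserves-individuals f global-f f-const β β-individual σ σ-incr
  with β-individual σ σ-incr
... | N , β≡βN =
  eventuallyConstant-resp
    (global-eventuallyEqual f global-f β σ (β (σ N)) (N , β≡βN))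
    (f-const (β (σ N)) σ σ-incr)

theorem4p6 : (X Y : Set) →
    ((f g : 𝒮 X → 𝒮 Y) → Global f → Global g →
    (∀ x s → f (const𝒮 x) s ≡ g (const𝒮 x) s) →
    ∀ α s → f α s ≡ g α s)
    ×
    ((f : 𝒮 X → 𝒮 Y) → Global f →
    (∀ x → Individual (f (const𝒮 x))) →
    ∀ β → Individual β → Individual (f β))
theorem4p6 X Y = global-unique , global-preserves-individuals
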